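{- Let $k,\ell\ge 2$ and suppose that every Boolean degree $1$ function on $J(k+\ell,k)$ is constant or equal to $x^\pm$ for some element $x$ of the ground set. Then every Boolean degree $1$ function $f$ on $J(k+\ell+1,k+1)$ is constant or equal to $x^\pm$ for some $x\in[k+\ell+1]$. Similarly, under the same hypothesis, every Boolean degree $1$ function on $J(k+\ell+1,k)$ is constant or equal to $x^\pm$ for some element $x$.
   Context: $J(n,k)$ is the set of all $k$-subsets of an $n$-element ground set. For an element $x$, $x^+(S)=1$ if $x\in S$ and $0$ otherwise, $x^-=1-x^+$. A Boolean degree $1$ function on $J(n,k)$ is a function with values in $\{0,1\}$ that can be written as $c+\sum_i c_i x_i^+$ with real constants.
   Formalization: The constants $c$ and $c_i$ in a Boolean degree $1$ function are rational rather than real. -}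

module Defs where

open import Data.Nat using (ℕ; zero; suc)
open import Data.Fin using (Fin)
import Data.Fin as F
open import Data.Fin.Subset using (Subset; ∣_∣; Side; inside; outside)
open import Data.Vec using (lookup)
open import Data.Bool using (Bool; true; false; not)
open import Data.Rational using (ℚ; 0ℚ; 1ℚ; _+_; _*_)
open import Data.Product using (Σ; ∃; ∃-syntax; _×_; proj₁)
open import Data.Sum using (_⊎_)
open import Relation.Binary.PropositionalEquality using (_≡_)

J : ℕ → ℕ → Set
J n k = Σ (Subset n) (λ S → ∣ S ∣ ≡ k)

mem : ∀ {n k} → Fin n → J n k → Bool
mem x S with lookup (proj₁ S) x
... | inside  = true
... | outside = false

toℚ : Bool → ℚ
toℚ true  = 1ℚ
toℚ false = 0ℚ

xplus : ∀ {n k} → Fin n → J n k → ℚ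
xplus x S = toℚ (mem x S)

sumFin : ∀ n → (Fin n → ℚ) → ℚ
sumFin zero    f = 0ℚ
sumFin (suc n) f = f F.zero + sumFin n (λ i → f (F.suc i))

IsDegree1 : ∀ {n k} → (J n k → Bool) → Set
IsDegree1 {n} {k} f =
  Σ ℚ λ c → Σ (Fin n → ℚ) λ cs → ((S : J n k) → toℚ (f S) ≡ c + sumFin n (λ i → cs i * xplus i S))

IsTrivial : ∀ {n k} → (J n k → Bool) → Set
IsTrivial {n} {k} f =
  (∃[ b ] ((S : J n k) → f S ≡ b))
  ⊎ (∃[ x ] (((S : J n k) → f S ≡ mem x S) ⊎ ((S : J n k) → f S ≡ not (mem x S))))

AllDeg1Trivial : ℕ → ℕ → Set
AllDeg1Trivial n k = (f : J n k → Bool) → IsDegree1 f → IsTrivial f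

module Submission where

-- Identify a k-set with its indicator vector, so that a degree 1 representation
-- f = c + Σ a_i x_i⁺ reads f(S) = c + weight a S.  The basic tool is the
-- exchange identity  f(U + p) + a_q = f(U + q) + a_p  for a set U missing p, q.
--
-- Extension (lemma extend): for 2 ≤ K < N, let f be Boolean of degree 1 on
-- J(N+1,K).  Its restriction g to the sets avoiding 0 lives on J(N,K), so it is
-- trivial.  If g ≡ b, exchanges inside g make a constant off 0, and exchanging 0
-- for a new element makes f constant on the sets containing 0.  If g = φ(x ∈ ·),
-- exchanging 0 for p ≠ x in two sets differing at x gives a_p = a_0, whence
-- f = φ(x ∈ ·).  In both cases f depends only on one membership, so is trivial.
--
-- Complementation J(n,k) ≅ J(n,n-k) turns x⁺ into x⁻, so the hypothesis also
-- holds on J(k+ℓ,ℓ).  Extending from J(k+ℓ,k) gives J(k+ℓ+1,k); extending from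
-- J(k+ℓ,ℓ) gives J(k+ℓ+1,ℓ), which is complementary to J(k+ℓ+1,k+1).

open import Defs
open import Data.Nat using (ℕ; zero; suc; _+_; _∸_; _≤_; _<_; z≤n; s≤s)
import Data.Nat.Properties as ℕP
open import Data.Fin using (Fin; punchOut) renaming (zero to fzero; suc to fsuc)
import Data.Fin.Properties as FinP
open import Data.Fin.Subset using (∣_∣; ∁)
open import Data.Fin.Subset.Properties using (∣∁p∣≡n∸∣p∣; ∣p∣≤∣x∷p∣)
open import Data.Vec using (Vec; []; _∷_; lookup; _[_]≔_; insertAt)
import Data.Vec.Properties as VecP
open import Data.Bool using (Bool; true; false; not; if_then_else_)
open import Data.Bool.Properties using (not-involutive)
open import Data.Rational using (ℚ; 0ℚ; 1ℚ)
import Data.Rational as ℚ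
import Data.Rational.Properties as ℚP
open import Algebra.Bundles using (CommutativeMonoid)
open import Algebra.Properties.Group ℚP.+-0-group using (∙-cancelˡ; ∙-cancelʳ)
open import Algebra.Properties.CommutativeSemigroup
  (CommutativeMonoid.commutativeSemigroup ℚP.+-0-commutativeMonoid) using (interchange; xy∙z≈xz∙y)
open import Data.Product using (Σ; ∃; _×_; _,_; proj₁; proj₂)
open import Data.Sum using (inj₁; inj₂)
open import Data.Empty using (⊥)
open import Function using (_∘_)
open import Relation.Binary.PropositionalEquality
  using (_≡_; _≢_; refl; sym; trans; cong; cong₂; subst; module ≡-Reasoning)
open import Relation.Nullary using (yes; no)

toℚ-injective : ∀ {u v} → toℚ u ≡ toℚ v → u ≡ v
toℚ-injective {true}  {true}  _ = refl
toℚ-injective {false} {false} _ = refl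
toℚ-injective {true}  {false} ()
toℚ-injective {false} {true}  ()

off-by-two : ∀ A B → 0ℚ ℚ.+ A ≡ 1ℚ ℚ.+ B → 1ℚ ℚ.+ A ≡ 0ℚ ℚ.+ B → ⊥
off-by-two A B e e′ with ∙-cancelʳ B (1ℚ ℚ.+ 1ℚ) 0ℚ two+B≡B
  where
  open ≡-Reasoning
  two+B≡B : (1ℚ ℚ.+ 1ℚ) ℚ.+ B ≡ 0ℚ ℚ.+ B
  two+B≡B = begin
    (1ℚ ℚ.+ 1ℚ) ℚ.+ B  ≡⟨ ℚP.+-assoc 1ℚ 1ℚ B ⟩
    1ℚ ℚ.+ (1ℚ ℚ.+ B)  ≡⟨ cong (1ℚ ℚ.+_) (sym e) ⟩
    1ℚ ℚ.+ (0ℚ ℚ.+ A)  ≡⟨ cong (1ℚ ℚ.+_) (ℚP.+-identityˡ A) ⟩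
    1ℚ ℚ.+ A           ≡⟨ e′ ⟩
    0ℚ ℚ.+ B           ∎
... | ()

-- If Booleans u, u′ satisfy u + A = y + B and u′ + A = (not y) + B, then A = B:
-- otherwise u - u′ = y - not y = ±1 is impossible for two 0/1 values shifted alike.
shift-equal : ∀ u u′ y A B → toℚ u ℚ.+ A ≡ toℚ y ℚ.+ B →
              toℚ u′ ℚ.+ A ≡ toℚ (not y) ℚ.+ B → A ≡ B
shift-equal true  _     true  A B e _  = ∙-cancelˡ 1ℚ A B e
shift-equal false _     false A B e _  = ∙-cancelˡ 0ℚ A B e
shift-equal _     true  false A B _ e′ = ∙-cancelˡ 1ℚ A B e′
shift-equal _     false true  A B _ e′ = ∙-cancelˡ 0ℚ A B e′
shift-equal false true  true  A B e e′ with off-by-two A B e e′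
... | ()
shift-equal true  false false A B e e′ with off-by-two A B e′ e
... | ()

sumFin-cong : ∀ n {F G : Fin n → ℚ} → (∀ i → F i ≡ G i) → sumFin n F ≡ sumFin n G
sumFin-cong zero    F≡G = refl
sumFin-cong (suc n) F≡G = cong₂ ℚ._+_ (F≡G fzero) (sumFin-cong n (F≡G ∘ fsuc))

sumFin-+ : ∀ n (F G : Fin n → ℚ) →
           sumFin n (λ i → F i ℚ.+ G i) ≡ sumFin n F ℚ.+ sumFin n G
sumFin-+ zero    F G = sym (ℚP.+-identityʳ 0ℚ)
sumFin-+ (suc n) F G =
  trans (cong (F fzero ℚ.+ G fzero ℚ.+_) (sumFin-+ n (F ∘ fsuc) (G ∘ fsuc)))
        (interchange (F fzero) (G fzero) _ _)

mem-lookup : ∀ {n k} (x : Fin n) (S : J n k) → mem x S ≡ lookup (proj₁ S) x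
mem-lookup x S with lookup (proj₁ S) x
... | true  = refl
... | false = refl

J-cong : ∀ {n k} (f : J n k → Bool) {v w : Vec Bool n} {p q} → v ≡ w → f (v , p) ≡ f (w , q)
J-cong f {v} refl = cong (λ e → f (v , e)) (ℕP.≡-irrelevant _ _)

weight : ∀ {n} → (Fin n → ℚ) → Vec Bool n → ℚ
weight {n} a v = sumFin n (λ i → a i ℚ.* toℚ (lookup v i))

weight-add : ∀ {n} (a : Fin n → ℚ) (v : Vec Bool n) p → lookup v p ≡ false →
             weight a (v [ p ]≔ true) ≡ weight a v ℚ.+ a p
weight-add a (false ∷ v) fzero refl = begin
  a fzero ℚ.* 1ℚ ℚ.+ W            ≡⟨ cong (ℚ._+ W) (ℚP.*-identityʳ (a fzero)) ⟩
  a fzero ℚ.+ W                   ≡⟨ ℚP.+-comm (a fzero) W ⟩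
  W ℚ.+ a fzero                   ≡⟨ cong (ℚ._+ a fzero) (sym (ℚP.+-identityˡ W)) ⟩
  (0ℚ ℚ.+ W) ℚ.+ a fzero          ≡⟨ cong (λ z → (z ℚ.+ W) ℚ.+ a fzero) (sym (ℚP.*-zeroʳ (a fzero))) ⟩
  (a fzero ℚ.* 0ℚ ℚ.+ W) ℚ.+ a fzero ∎
  where
  open ≡-Reasoning
  W = weight (a ∘ fsuc) v
weight-add a (b ∷ v) (fsuc p) p∉v =
  trans (cong (a fzero ℚ.* toℚ b ℚ.+_) (weight-add (a ∘ fsuc) v p p∉v))
        (sym (ℚP.+-assoc (a fzero ℚ.* toℚ b) (weight (a ∘ fsuc) v) (a (fsuc p))))

size-add : ∀ {n r} (v : Vec Bool n) p → ∣ v ∣ ≡ r → lookup v p ≡ false →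
           ∣ v [ p ]≔ true ∣ ≡ suc r
size-add (false ∷ v) fzero    refl refl = refl
size-add (true ∷ v)  (fsuc p) refl p∉v  = cong suc (size-add v p refl p∉v)
size-add (false ∷ v) (fsuc p) refl p∉v  = size-add v p refl p∉v

record Represents {n k} (f : J n k → Bool) (c : ℚ) (a : Fin n → ℚ) : Set where
  constructor representation
  field
    at : ∀ v (e : ∣ v ∣ ≡ k) → toℚ (f (v , e)) ≡ c ℚ.+ weight a v
open Represents

xplus-weight : ∀ {n k} (a : Fin n → ℚ) (S : J n k) →
               sumFin n (λ i → a i ℚ.* xplus i S) ≡ weight a (proj₁ S)
xplus-weight {n} a S = sumFin-cong n (λ i → cong (λ b → a i ℚ.* toℚ b) (mem-lookup i S))

represents : ∀ {n k} {f : J n k → Bool} {c a} →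
             (∀ S → toℚ (f S) ≡ c ℚ.+ sumFin n (λ i → a i ℚ.* xplus i S)) → Represents f c a
represents {c = c} {a} rep = representation λ v e → trans (rep (v , e)) (cong (c ℚ.+_) (xplus-weight a (v , e)))

degree1 : ∀ {n k} {f : J n k → Bool} {c a} → Represents f c a → IsDegree1 f
degree1 {c = c} {a} rep =
  c , a , λ S → trans (at rep (proj₁ S) (proj₂ S)) (cong (c ℚ.+_) (sym (xplus-weight a S)))

exchange : ∀ {n k} {f : J n k → Bool} {c a} → Represents f c a →
           (u : Vec Bool n) (p q : Fin n) → lookup u p ≡ false → lookup u q ≡ false →
           (ep : ∣ u [ p ]≔ true ∣ ≡ k) (eq : ∣ u [ q ]≔ true ∣ ≡ k) →
           toℚ (f (u [ p ]≔ true , ep)) ℚ.+ a q ≡ toℚ (f (u [ q ]≔ true , eq)) ℚ.+ a p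
exchange {f = f} {c} {a} rep u p q p∉u q∉u ep eq = begin
  toℚ (f (u [ p ]≔ true , ep)) ℚ.+ a q   ≡⟨ cong (ℚ._+ a q) (at rep _ ep) ⟩
  (c ℚ.+ weight a (u [ p ]≔ true)) ℚ.+ a q ≡⟨ cong (λ z → (c ℚ.+ z) ℚ.+ a q) (weight-add a u p p∉u) ⟩
  (c ℚ.+ (W ℚ.+ a p)) ℚ.+ a q           ≡⟨ cong (ℚ._+ a q) (sym (ℚP.+-assoc c W (a p))) ⟩
  ((c ℚ.+ W) ℚ.+ a p) ℚ.+ a q           ≡⟨ xy∙z≈xz∙y (c ℚ.+ W) (a p) (a q) ⟩
  ((c ℚ.+ W) ℚ.+ a q) ℚ.+ a p           ≡⟨ cong (ℚ._+ a p) (ℚP.+-assoc c W (a q)) ⟩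
  (c ℚ.+ (W ℚ.+ a q)) ℚ.+ a p           ≡⟨ cong (λ z → (c ℚ.+ z) ℚ.+ a p) (sym (weight-add a u q q∉u)) ⟩
  (c ℚ.+ weight a (u [ q ]≔ true)) ℚ.+ a p ≡⟨ cong (ℚ._+ a p) (sym (at rep _ eq)) ⟩
  toℚ (f (u [ q ]≔ true , eq)) ℚ.+ a p   ∎
  where
  open ≡-Reasoning
  W = weight a u

subsetOfSize : ∀ {m r} → r ≤ m → Σ (Vec Bool m) (λ v → ∣ v ∣ ≡ r)
subsetOfSize {zero}  z≤n       = [] , refl
subsetOfSize {suc m} z≤n       = let (v , e) = subsetOfSize {m} z≤n in false ∷ v , e
subsetOfSize         (s≤s r≤m) = let (v , e) = subsetOfSize r≤m in true ∷ v , cong suc e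

size-insert-false : ∀ {m} (v : Vec Bool m) i → ∣ insertAt v i false ∣ ≡ ∣ v ∣
size-insert-false v          fzero    = refl
size-insert-false (true ∷ v)  (fsuc i) = cong suc (size-insert-false v i)
size-insert-false (false ∷ v) (fsuc i) = size-insert-false v i

avoiding : ∀ {m r} (p q : Fin (suc (suc m))) → p ≢ q → r ≤ m →
           Σ (Vec Bool (suc (suc m))) (λ v → lookup v p ≡ false × lookup v q ≡ false × ∣ v ∣ ≡ r)
avoiding p q p≢q r≤m =
  v , VecP.insertAt-lookup w p false ,
  trans (cong (lookup v) (sym (FinP.punchIn-punchOut p≢q)))
        (trans (VecP.insertAt-punchIn w p false (punchOut p≢q))
               (VecP.insertAt-lookup R (punchOut p≢q) false)) ,
  trans (size-insert-false w p) (trans (size-insert-false R (punchOut p≢q)) (proj₂ (subsetOfSize r≤m)))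
  where
  R = proj₁ (subsetOfSize r≤m)
  w = insertAt R (punchOut p≢q) false
  v = insertAt w p false

absent : ∀ {n} (v : Vec Bool (suc n)) → ∣ v ∣ ≤ n → ∃ λ p → lookup v p ≡ false
absent (false ∷ v) _          = fzero , refl
absent (true ∷ v)  (s≤s ∣v∣≤n) = let (p , p∉v) = absent v ∣v∣≤n in fsuc p , p∉v

absentExcept : ∀ {n} (v : Vec Bool (suc (suc n))) → ∣ v ∣ ≤ n → (x : Fin (suc (suc n))) →
               ∃ λ p → p ≢ x × lookup v p ≡ false
absentExcept (b ∷ v) ∣v∣≤n fzero =
  let (p , p∉v) = absent v (ℕP.≤-trans (∣p∣≤∣x∷p∣ b v) ∣v∣≤n) in fsuc p , (λ ()) , p∉v
absentExcept (false ∷ v) _           (fsuc x) = fzero , (λ ()) , refl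
absentExcept (true ∷ v)  (s≤s ∣v∣≤n) (fsuc x) =
  let (p , p≢x , p∉v) = absentExcept v ∣v∣≤n x in fsuc p , p≢x ∘ FinP.suc-injective , p∉v

-- A function that depends only on the membership of one element x is trivial:
-- the four maps Bool → Bool give the two constants, x⁺ and x⁻.
dependsOnOne : ∀ {n k} (f : J n k → Bool) (x : Fin n) (φ : Bool → Bool) →
               (∀ S → f S ≡ φ (lookup (proj₁ S) x)) → IsTrivial f
dependsOnOne f x φ f≡φ = classify (φ true) (φ false) refl refl
  where
  through : (ψ : Bool → Bool) → φ true ≡ ψ true → φ false ≡ ψ false → ∀ S → f S ≡ ψ (mem x S)
  through ψ φt φf S = trans (f≡φ S) (trans (cong φ (sym (mem-lookup x S))) (agree (mem x S)))
    where
    agree : ∀ b → φ b ≡ ψ b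
    agree true  = φt
    agree false = φf
  classify : ∀ t e → φ true ≡ t → φ false ≡ e → IsTrivial f
  classify true  true  φt φf = inj₁ (true  , through (λ _ → true)  φt φf)
  classify false false φt φf = inj₁ (false , through (λ _ → false) φt φf)
  classify true  false φt φf = inj₂ (x , inj₁ (through (λ b → b) φt φf))
  classify false true  φt φf = inj₂ (x , inj₂ (through not φt φf))

-- A represented function that is constant on J(m+2, r+1), 0 ≤ r ≤ m, has all
-- coefficients equal: exchanging p for q does not change the value.
equal-coefficients : ∀ {m r} {f : J (suc (suc m)) (suc r) → Bool} {c a} → Represents f c a →
                     (b : Bool) → (∀ S → f S ≡ b) → r ≤ m → ∀ p q → a p ≡ a q
equal-coefficients {f = f} {a = a} rep b f≡b r≤m p q with p FinP.≟ q
... | yes p≡q = cong a p≡q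
... | no  p≢q = sym (∙-cancelˡ (toℚ b) (a q) (a p) b+aq≡b+ap)
  where
  u = avoiding p q p≢q r≤m
  p∉u = proj₁ (proj₂ u)
  q∉u = proj₁ (proj₂ (proj₂ u))
  ∣u∣ = proj₂ (proj₂ (proj₂ u))
  b+aq≡b+ap : toℚ b ℚ.+ a q ≡ toℚ b ℚ.+ a p
  ep = size-add (proj₁ u) p ∣u∣ p∉u
  eq = size-add (proj₁ u) q ∣u∣ q∉u
  b+aq≡b+ap = trans (cong (λ z → toℚ z ℚ.+ a q) (sym (f≡b (proj₁ u [ p ]≔ true , ep))))
    (trans (exchange rep (proj₁ u) p q p∉u q∉u ep eq)
           (cong (λ z → toℚ z ℚ.+ a p) (f≡b (proj₁ u [ q ]≔ true , eq))))

module Extension {m j : ℕ} (j<m : j < m) (f : J (suc (suc (suc m))) (suc (suc j)) → Bool)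
                 {c : ℚ} {a : Fin (suc (suc (suc m))) → ℚ} (rep : Represents f c a) where

  g : J (suc (suc m)) (suc (suc j)) → Bool
  g (T , e) = f (false ∷ T , e)

  g-represented : Represents g c (a ∘ fsuc)
  g-represented = representation λ T e → trans (at rep (false ∷ T) e) (cong (c ℚ.+_) (absent-zero T))
    where
    absent-zero : ∀ T → a fzero ℚ.* 0ℚ ℚ.+ weight (a ∘ fsuc) T ≡ weight (a ∘ fsuc) T
    absent-zero T = trans (cong (ℚ._+ weight (a ∘ fsuc) T) (ℚP.*-zeroʳ (a fzero))) (ℚP.+-identityˡ _)

  trade-first : ∀ T (e : suc ∣ T ∣ ≡ suc (suc j)) p (p∉T : lookup T p ≡ false) →
                toℚ (f (true ∷ T , e)) ℚ.+ a (fsuc p) ≡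
                toℚ (g (T [ p ]≔ true , size-add T p (ℕP.suc-injective e) p∉T)) ℚ.+ a fzero
  trade-first T e p p∉T =
    exchange rep (false ∷ T) fzero (fsuc p) refl p∉T e (size-add T p (ℕP.suc-injective e) p∉T)

  -- Sets {0} ∪ T have |T| = j+1 ≤ m, so there is always room to trade.
  room : ∀ (T : Vec Bool (suc (suc m))) → suc ∣ T ∣ ≡ suc (suc j) → ∣ T ∣ ≤ m
  room T e = ℕP.≤-trans (ℕP.≤-reflexive (ℕP.suc-injective e)) j<m

  -- g ≡ b: then f only depends on whether 0 ∈ S.
  constantCase : (b : Bool) → (∀ S → g S ≡ b) → IsTrivial f
  constantCase b g≡b = dependsOnOne f fzero (λ z → if z then f₀ else b) f-values
    where
    tail-equal : ∀ p q → a (fsuc p) ≡ a (fsuc q)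
    tail-equal = equal-coefficients g-represented b g≡b j<m
    first-in : ∀ T e p → lookup T p ≡ false → toℚ (f (true ∷ T , e)) ℚ.+ a (fsuc p) ≡ toℚ b ℚ.+ a fzero
    first-in T e p p∉T = trans (trade-first T e p p∉T) (cong (λ z → toℚ z ℚ.+ a fzero) (g≡b _))
    T₀ = subsetOfSize (ℕP.m≤n⇒m≤1+n (ℕP.m≤n⇒m≤1+n j<m))
    e₀ : suc ∣ proj₁ T₀ ∣ ≡ suc (suc j)
    e₀ = cong suc (proj₂ T₀)
    p₀ = absent (proj₁ T₀) (ℕP.m≤n⇒m≤1+n (room (proj₁ T₀) e₀))
    f₀ = f (true ∷ proj₁ T₀ , e₀)
    first-constant : ∀ T e → f (true ∷ T , e) ≡ f₀
    first-constant T e =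
      let (p , p∉T) = absent T (ℕP.m≤n⇒m≤1+n (room T e)) in
      toℚ-injective (∙-cancelʳ (a (fsuc p)) _ _
        (trans (first-in T e p p∉T)
          (sym (trans (cong (toℚ f₀ ℚ.+_) (tail-equal p (proj₁ p₀))) (first-in _ e₀ _ (proj₂ p₀))))))
    f-values : ∀ S → f S ≡ (if lookup (proj₁ S) fzero then f₀ else b)
    f-values (true ∷ T , e)  = first-constant T e
    f-values (false ∷ T , e) = g≡b (T , e)

  -- g = φ(x ∈ ·) with φ non-constant: then f = φ(x ∈ ·) too.
  literalCase : (φ : Bool → Bool) → φ false ≡ not (φ true) → (x : Fin (suc (suc m))) →
                (∀ S → g S ≡ φ (lookup (proj₁ S) x)) → IsTrivial f
  literalCase φ flips x g≡φ = dependsOnOne f (fsuc x) φ f-values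
    where
    -- trading 0 for p ≠ x does not change the membership of x
    traded : ∀ T e p → p ≢ x → lookup T p ≡ false →
             toℚ (f (true ∷ T , e)) ℚ.+ a (fsuc p) ≡ toℚ (φ (lookup T x)) ℚ.+ a fzero
    traded T e p p≢x p∉T = trans (trade-first T e p p∉T)
      (cong (λ z → toℚ z ℚ.+ a fzero)
            (trans (g≡φ _) (cong φ (VecP.lookup∘update′ (p≢x ∘ sym) T true))))
    -- compare a set containing x with one avoiding x, both avoiding p
    weight-first : ∀ p → p ≢ x → a (fsuc p) ≡ a fzero
    weight-first p p≢x = shift-equal (f (true ∷ T₁ , e₁)) (f (true ∷ T₂ , e₂)) (φ true) (a (fsuc p)) (a fzero)
      (trans (traded T₁ e₁ p p≢x p∉T₁) (cong (λ z → toℚ (φ z) ℚ.+ a fzero) x∈T₁))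
      (trans (traded T₂ e₂ p p≢x p∉T₂) (cong (λ z → toℚ z ℚ.+ a fzero) (trans (cong φ x∉T₂) flips)))
      where
      U = avoiding p x p≢x (ℕP.≤-trans (ℕP.n≤1+n j) j<m)
      T₁ = proj₁ U [ x ]≔ true
      e₁ : suc ∣ T₁ ∣ ≡ suc (suc j)
      e₁ = cong suc (size-add (proj₁ U) x (proj₂ (proj₂ (proj₂ U))) (proj₁ (proj₂ (proj₂ U))))
      p∉T₁ = trans (VecP.lookup∘update′ p≢x (proj₁ U) true) (proj₁ (proj₂ U))
      x∈T₁ = VecP.lookup∘update x (proj₁ U) true
      V = avoiding p x p≢x j<m
      T₂ = proj₁ V
      e₂ : suc ∣ T₂ ∣ ≡ suc (suc j)
      e₂ = cong suc (proj₂ (proj₂ (proj₂ V)))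
      p∉T₂ = proj₁ (proj₂ V)
      x∉T₂ = proj₁ (proj₂ (proj₂ V))
    f-values : ∀ S → f S ≡ φ (lookup (proj₁ S) (fsuc x))
    f-values (false ∷ T , e) = g≡φ (T , e)
    f-values (true ∷ T , e)  =
      let (p , p≢x , p∉T) = absentExcept T (room T e) x in
      toℚ-injective (∙-cancelʳ (a (fsuc p)) _ _
        (trans (traded T e p p≢x p∉T) (cong (toℚ (φ (lookup T x)) ℚ.+_) (sym (weight-first p p≢x)))))

  extended : IsTrivial g → IsTrivial f
  extended (inj₁ (b , g≡b))         = constantCase b g≡b
  extended (inj₂ (x , inj₁ g≡x⁺)) =
    literalCase (λ b → b) refl x (λ S → trans (g≡x⁺ S) (mem-lookup x S))
  extended (inj₂ (x , inj₂ g≡x⁻)) =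
    literalCase not refl x (λ S → trans (g≡x⁻ S) (cong not (mem-lookup x S)))

extend : ∀ {N K} → 2 ≤ K → K < N → AllDeg1Trivial N K → AllDeg1Trivial (suc N) K
extend {suc (suc m)} {suc (suc j)} (s≤s (s≤s z≤n)) (s≤s (s≤s j<m)) hyp f (c , a , rep) =
  extended (hyp g (degree1 g-represented))
  where open Extension j<m f (represents {c = c} {a} rep)

complement : ∀ {n k j} → k + j ≡ n → J n k → J n j
complement {n} {k} {j} k+j≡n (S , ∣S∣≡k) = ∁ S , size
  where
  open ≡-Reasoning
  size : ∣ ∁ S ∣ ≡ j
  size = begin
    ∣ ∁ S ∣      ≡⟨ ∣∁p∣≡n∸∣p∣ S ⟩
    n ∸ ∣ S ∣    ≡⟨ cong (n ∸_) ∣S∣≡k ⟩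
    n ∸ k        ≡⟨ cong (_∸ k) (sym k+j≡n) ⟩
    k + j ∸ k    ≡⟨ ℕP.m+n∸m≡n k j ⟩
    j            ∎

mem-complement : ∀ {n k j} (e : k + j ≡ n) x (S : J n k) → mem x (complement e S) ≡ not (mem x S)
mem-complement e x S = trans (mem-lookup x (complement e S))
  (trans (VecP.lookup-map x not (proj₁ S)) (cong not (sym (mem-lookup x S))))

∁-involutive : ∀ {n} (v : Vec Bool n) → ∁ (∁ v) ≡ v
∁-involutive v =
  trans (sym (VecP.map-∘ not not v)) (trans (VecP.map-cong not-involutive v) (VecP.map-id v))

-- x⁺ of the complement is 1 - x⁺, so a(x⁺ ∘ ∁) = a + (-a) x⁺.
complement-term : ∀ α b → α ℚ.* toℚ (not b) ≡ α ℚ.+ (ℚ.- α) ℚ.* toℚ b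
complement-term α true  = trans (ℚP.*-zeroʳ α)
  (sym (trans (cong (α ℚ.+_) (ℚP.*-identityʳ (ℚ.- α))) (ℚP.+-inverseʳ α)))
complement-term α false = trans (ℚP.*-identityʳ α)
  (sym (trans (cong (α ℚ.+_) (ℚP.*-zeroʳ (ℚ.- α))) (ℚP.+-identityʳ α)))

degree1-complement : ∀ {n k j} (e : k + j ≡ n) (f : J n j → Bool) → IsDegree1 f →
                     IsDegree1 (f ∘ complement e)
degree1-complement {n} e f (c , a , rep) = c ℚ.+ sumFin n a , (λ i → ℚ.- a i) , λ S → begin
  toℚ (f (complement e S))
    ≡⟨ rep (complement e S) ⟩
  c ℚ.+ sumFin n (λ i → a i ℚ.* xplus i (complement e S))
    ≡⟨ cong (c ℚ.+_) (sumFin-cong n (λ i → trans (cong (λ b → a i ℚ.* toℚ b) (mem-complement e i S))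
                                                 (complement-term (a i) (mem i S)))) ⟩
  c ℚ.+ sumFin n (λ i → a i ℚ.+ (ℚ.- a i) ℚ.* xplus i S)
    ≡⟨ cong (c ℚ.+_) (sumFin-+ n a _) ⟩
  c ℚ.+ (sumFin n a ℚ.+ sumFin n (λ i → (ℚ.- a i) ℚ.* xplus i S))
    ≡⟨ sym (ℚP.+-assoc c _ _) ⟩
  (c ℚ.+ sumFin n a) ℚ.+ sumFin n (λ i → (ℚ.- a i) ℚ.* xplus i S) ∎
  where open ≡-Reasoning

complement-closed : ∀ {n k j} → AllDeg1Trivial n k → k + j ≡ n → AllDeg1Trivial n j
complement-closed {k = k} {j} hyp k+j≡n f deg =
  pull-back (hyp (f ∘ complement k+j≡n) (degree1-complement k+j≡n f deg))
  where
  j+k≡n = trans (ℕP.+-comm j k) k+j≡n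
  double : ∀ S → f S ≡ f (complement k+j≡n (complement j+k≡n S))
  double S = J-cong f (sym (∁-involutive (proj₁ S)))
  pull-back : IsTrivial (f ∘ complement k+j≡n) → IsTrivial f
  pull-back (inj₁ (b , const)) = inj₁ (b , λ S → trans (double S) (const (complement j+k≡n S)))
  pull-back (inj₂ (x , inj₁ pos)) =
    inj₂ (x , inj₂ λ S → trans (double S) (trans (pos (complement j+k≡n S)) (mem-complement j+k≡n x S)))
  pull-back (inj₂ (x , inj₂ neg)) =
    inj₂ (x , inj₁ λ S → trans (double S)
      (trans (neg (complement j+k≡n S)) (trans (cong not (mem-complement j+k≡n x S)) (not-involutive (mem x S)))))

lemma3p2 : (k ℓ : ℕ) → 2 ≤ k → 2 ≤ ℓ → AllDeg1Trivial (k + ℓ) k →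
           AllDeg1Trivial (k + ℓ + 1) (k + 1) × AllDeg1Trivial (k + ℓ + 1) k
lemma3p2 k ℓ 2≤k 2≤ℓ hyp = upper , lower
  where
  n+1≡ : suc (k + ℓ) ≡ k + ℓ + 1
  n+1≡ = ℕP.+-comm 1 (k + ℓ)
  lower : AllDeg1Trivial (k + ℓ + 1) k
  lower = subst (λ N → AllDeg1Trivial N k) n+1≡
    (extend 2≤k (ℕP.m<m+n k (ℕP.<-≤-trans (s≤s z≤n) 2≤ℓ)) hyp)
  -- J(k+ℓ+1, k+1): complement, extend J(k+ℓ, ℓ), complement back
  upper : AllDeg1Trivial (k + ℓ + 1) (k + 1)
  upper = complement-closed
    (subst (λ N → AllDeg1Trivial N ℓ) n+1≡
      (extend 2≤ℓ (ℕP.m<n+m ℓ (ℕP.<-≤-trans (s≤s z≤n) 2≤k)) (complement-closed hyp refl)))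
    (trans (sym (ℕP.+-assoc ℓ k 1)) (cong (_+ 1) (ℕP.+-comm ℓ k)))
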